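{- Let $k$ be a multiple of $4$ with $k\ge 4$. There are infinitely many $n$ (with $k\le n$ and $k\le 2^{n/4}$) such that every deterministic OBDD on $n$ variables computing $\mathtt{NotEQS^k_{n}}$ has width at least $2^{k/4}$.
   Context: For $\nu\in\{0,1\}^n$, among the first $k$ bits, call the odd positions marker bits and the even positions value bits. For $1\le i\le k/2$, the value bit $\nu_{2i}$ is appended (in order of increasing $i$) to the string $\alpha(\nu)$ if $\nu_{2i-1}=0$ and to $\beta(\nu)$ if $\nu_{2i-1}=1$. $\mathtt{NotEQS^k_{n}}(\nu)=0$ if $\alpha(\nu)=\beta(\nu)$ and $1$ otherwise. A deterministic OBDD on $x_1,\dots,x_n$ with order $\pi$ (a permutation of $\{1,\dots,n\}$) is a leveled directed acyclic graph with levels $0,\dots,n$, a single source at level $0$, every node at level $j-1$ having exactly one outgoing edge labelled $0$ and one labelled $1$ to nodes at level $j$, and nodes at level $n$ marked accepting or rejecting; on input $\nu$ one follows from the source at step $j$ the edge labelled $\nu_{\pi(j)}$ and outputs $1$ iff an accepting node is reached. Width is the maximum number of nodes in a level. -}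

module Defs where

open import Data.Nat using (ℕ; zero; suc; _⊔_)
open import Data.Bool using (Bool; true; false)
open import Data.Product using (Σ; _×_; _,_; proj₁; proj₂)
open import Data.Fin using (Fin; zero)
open import Data.List using (List; []; _∷_; map; take)
import Data.List.Properties as LP
import Data.Bool.Properties as BP
open import Data.Vec using (Vec; []; _∷_; lookup; tabulate; toList)
open import Data.Fin.Permutation using (Permutation′; _⟨$⟩ʳ_)
open import Relation.Nullary using (yes; no)
open import Relation.Binary.PropositionalEquality using (_≡_)

-- Split a bit list into consecutive (marker , value) pairs
-- (bits 2i-1, 2i in 1-based numbering); a trailing odd bit is dropped.
pairs : List Bool → List (Bool × Bool)
pairs (m ∷ v ∷ bs) = (m , v) ∷ pairs bs
pairs _ = []

valuesWithMarker : Bool → List (Bool × Bool) → List Bool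
valuesWithMarker b [] = []
valuesWithMarker false ((false , v) ∷ ps) = v ∷ valuesWithMarker false ps
valuesWithMarker false ((true  , v) ∷ ps) = valuesWithMarker false ps
valuesWithMarker true  ((false , v) ∷ ps) = valuesWithMarker true ps
valuesWithMarker true  ((true  , v) ∷ ps) = v ∷ valuesWithMarker true ps

alpha : (k : ℕ) {n : ℕ} → Vec Bool n → List Bool
alpha k ν = valuesWithMarker false (pairs (take k (toList ν)))

beta : (k : ℕ) {n : ℕ} → Vec Bool n → List Bool
beta k ν = valuesWithMarker true (pairs (take k (toList ν)))

NotEQS : (k n : ℕ) → Vec Bool n → Bool
NotEQS k n ν with LP.≡-dec BP._≟_ (alpha k ν) (beta k ν)
... | yes _ = false
... | no  _ = true

-- Layers r s : the remaining r levels of transitions, starting from a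
-- level with s nodes (nodes of a level of size s are Fin s).  With r = 0
-- this is the last level, where each node is marked accepting (true)
-- or rejecting (false).
Layers : ℕ → ℕ → Set
Layers zero    s = Fin s → Bool
Layers (suc r) s = Σ ℕ λ s′ → (Fin s → Bool → Fin s′) × Layers r s′

run : ∀ {r s} → Layers r s → Fin s → Vec Bool r → Bool
run {zero}  acc            u []       = acc u
run {suc r} (s′ , δ , L)   u (b ∷ bs) = run L (δ u b) bs

layersWidth : ∀ {r} s → Layers r s → ℕ
layersWidth {zero}  s _            = s
layersWidth {suc r} s (s′ , _ , L) = s ⊔ layersWidth s′ L

-- An OBDD on x_1..x_n: a variable order π and levels 0..n with a
-- single source at level 0.
record OBDD (n : ℕ) : Set where
  field
    order  : Permutation′ n
    layers : Layers n 1

open OBDD public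

eval : ∀ {n} → OBDD n → Vec Bool n → Bool
eval {n} B ν = run (layers B) zero (tabulate λ j → lookup ν (order B ⟨$⟩ʳ j))

width : ∀ {n} → OBDD n → ℕ
width B = layersWidth 1 (layers B)

Computes : ∀ {n} → OBDD n → (Vec Bool n → Bool) → Set
Computes {n} B f = (ν : Vec Bool n) → eval B ν ≡ f ν

-- Write k = 4q and let π be the variable order of the OBDD. Among the 2q value bits of the
-- first k input bits, choose a step t of the order such that exactly q of them are read
-- before t (a discrete intermediate value argument, since the count grows by at most one per
-- step). Mark exactly those q pairs as α-pairs and the other q as β-pairs, and fill their value
-- bits with the binary expansions of x, y < 2^q. The resulting inputs form a fooling set: up to
-- step t the OBDD sees only x and afterwards only y, and it rejects exactly when x = y. So the
-- 2^q states reached at level t are pairwise distinct.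
module Submission where

open import Defs
open import Data.Nat using (ℕ; zero; suc; _+_; _*_; _≤_; _<_; _^_; _/_; z≤n; s≤s; z<s; s<s; _≤?_)
open import Data.Nat.Divisibility using (_∣_; divides)
open import Data.Nat.DivMod using (m*n/n≡m)
open import Data.Nat.Properties
open import Data.Bool using (Bool; true; false; if_then_else_)
import Data.Bool.Properties as BP
open import Data.Product using (Σ; _×_; _,_; proj₁; proj₂; uncurry; ∃-syntax)
open import Data.List using (List; []; _∷_; length; take; drop)
import Data.List.Properties as LP
open import Data.Vec using (Vec; lookup; tabulate; toList)
open import Data.Vec.Properties using (lookup∘tabulate; tabulate-cong)
open import Data.Fin as Fin using (Fin; toℕ; fromℕ<; remQuot; combine)
open import Data.Fin.Properties using (injective⇒≤; toℕ-injective; toℕ<n; toℕ-fromℕ<; 2↔Bool; combine-remQuot)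
open import Data.Fin.Permutation using (Permutation′; _⟨$⟩ʳ_; _⟨$⟩ˡ_; inverseˡ; inverseʳ)
open import Function using (_∘_; Inverse)
open import Relation.Binary.PropositionalEquality
open import Relation.Nullary using (yes; no; does; contradiction)
open import Relation.Nullary.Decidable using (dec-true; dec-false)
open import Relation.Binary.Definitions using (tri<; tri≈; tri>)

s≤layersWidth : ∀ {r} s (L : Layers r s) → s ≤ layersWidth s L
s≤layersWidth {zero}  s _           = ≤-refl
s≤layersWidth {suc r} s (_ , _ , L) = m≤m⊔n s _

SplitAt : ∀ {T r} → ℕ → (Fin T → Fin T → Fin r → Bool) → Set
SplitAt t w = (∀ x y y′ j → toℕ j < t → w x y j ≡ w x y′ j)
            × (∀ x x′ y j → t ≤ toℕ j → w x y j ≡ w x′ y j)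

distinct-states⇒≤layersWidth : ∀ {T r s} (L : Layers r s) (h : Fin T → Fin s) (w : Fin T → Fin T → Fin r → Bool) →
  (∀ x x′ y → tabulate (w x y) ≡ tabulate (w x′ y)) →
  (∀ x y → run L (h x) (tabulate (w x y)) ≡ false → x ≡ y) →
  (∀ x → run L (h x) (tabulate (w x x)) ≡ false) →
  T ≤ layersWidth s L
distinct-states⇒≤layersWidth {s = s} L h w ignores-x rejects⇒≡ rejects-diagonal =
  ≤-trans (injective⇒≤ h-injective) (s≤layersWidth s L)
  where
  h-injective : ∀ {x x′} → h x ≡ h x′ → x ≡ x′
  h-injective {x} {x′} hx≡hx′ = rejects⇒≡ x x′ (begin
    run L (h x) (tabulate (w x x′))   ≡⟨ cong (run L (h x)) (ignores-x x x′ x′) ⟩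
    run L (h x) (tabulate (w x′ x′))  ≡⟨ cong (λ u → run L u (tabulate (w x′ x′))) hx≡hx′ ⟩
    run L (h x′) (tabulate (w x′ x′)) ≡⟨ rejects-diagonal x′ ⟩
    false                             ∎)
    where open ≡-Reasoning

fooling-bound : ∀ {T r s} (L : Layers r s) (h : Fin T → Fin s) (w : Fin T → Fin T → Fin r → Bool) t →
  SplitAt t w →
  (∀ x y → run L (h x) (tabulate (w x y)) ≡ false → x ≡ y) →
  (∀ x → run L (h x) (tabulate (w x x)) ≡ false) →
  T ≤ layersWidth s L
fooling-bound L h w zero (_ , after) =
  distinct-states⇒≤layersWidth L h w (λ x x′ y → tabulate-cong (λ j → after x x′ y j z≤n))
fooling-bound {r = zero} L h w (suc t) _ =
  distinct-states⇒≤layersWidth L h w (λ _ _ _ → refl)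
fooling-bound {T} {suc r} {s} (s′ , δ , L) h w (suc t) (before , after) rejects⇒≡ rejects-diagonal =
  ≤-trans (fooling-bound L h′ w′ t split′ (λ x y → rejects⇒≡ x y ∘ trans (step x y))
                         (λ x → trans (sym (step x x)) (rejects-diagonal x)))
          (m≤n⊔m s _)
  where
  h′ : Fin T → Fin s′
  h′ x = δ (h x) (w x x Fin.zero)
  w′ : Fin T → Fin T → Fin r → Bool
  w′ x y = w x y ∘ Fin.suc
  step : ∀ x y → run (s′ , δ , L) (h x) (tabulate (w x y)) ≡ run L (h′ x) (tabulate (w′ x y))
  step x y = cong (λ b → run L (δ (h x) b) (tabulate (w′ x y))) (before x y x Fin.zero z<s)
  split′ : SplitAt t w′
  split′ = (λ x y y′ j j<t → before x y y′ (Fin.suc j) (s<s j<t))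
         , (λ x x′ y j t≤j → after x x′ y (Fin.suc j) (s≤s t≤j))

obdd-fooling-bound : ∀ {n T} (B : OBDD n) (ν : Fin T → Fin T → Vec Bool n) t →
  SplitAt t (λ x y j → lookup (ν x y) (order B ⟨$⟩ʳ j)) →
  (∀ x y → eval B (ν x y) ≡ false → x ≡ y) →
  (∀ x → eval B (ν x x) ≡ false) →
  T ≤ width B
obdd-fooling-bound B ν = fooling-bound (layers B) (λ _ → Fin.zero) (λ x y j → lookup (ν x y) (order B ⟨$⟩ʳ j))

-- Junk value 0 for p ≥ n.
readingTime : ∀ {n} → Permutation′ n → ℕ → ℕ
readingTime {n} π p with p <? n
... | yes p<n = toℕ (π ⟨$⟩ˡ fromℕ< p<n)
... | no  _   = 0

module _ {n} (π : Permutation′ n) where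

  readingTime-⟨$⟩ʳ : ∀ j → readingTime π (toℕ (π ⟨$⟩ʳ j)) ≡ toℕ j
  readingTime-⟨$⟩ʳ j with toℕ (π ⟨$⟩ʳ j) <? n
  ... | yes p<n = trans (cong (toℕ ∘ (π ⟨$⟩ˡ_)) (toℕ-injective (toℕ-fromℕ< p<n))) (cong toℕ (inverseˡ π))
  ... | no  p≮n = contradiction (toℕ<n _) p≮n

  readingTime<n : ∀ {p} → p < n → readingTime π p < n
  readingTime<n {p} p<n with p <? n
  ... | yes _   = toℕ<n _
  ... | no  p≮n = contradiction p<n p≮n

  readingTime-injective : ∀ {p p′} → p < n → p′ < n → readingTime π p ≡ readingTime π p′ → p ≡ p′
  readingTime-injective {p} {p′} p<n p′<n eq with p <? n | p′ <? n
  ... | yes a | yes b = begin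
    p                                    ≡⟨ toℕ-fromℕ< a ⟨
    toℕ (fromℕ< a)                       ≡⟨ cong toℕ (inverseʳ π) ⟨
    toℕ (π ⟨$⟩ʳ (π ⟨$⟩ˡ fromℕ< a))       ≡⟨ cong (toℕ ∘ (π ⟨$⟩ʳ_)) (toℕ-injective eq) ⟩
    toℕ (π ⟨$⟩ʳ (π ⟨$⟩ˡ fromℕ< b))       ≡⟨ cong toℕ (inverseʳ π) ⟩
    toℕ (fromℕ< b)                       ≡⟨ toℕ-fromℕ< b ⟩
    p′                                   ∎
    where open ≡-Reasoning
  ... | no p≮n | _      = contradiction p<n p≮n
  ... | _      | no p′≮n = contradiction p′<n p′≮n

discrete-ivt : (f : ℕ → ℕ) → (∀ t → f (suc t) ≤ suc (f t)) →
  ∀ {q} T → f 0 ≤ q → q ≤ f T → ∃[ t ] f t ≡ q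
discrete-ivt f step zero    f0≤q q≤f0 = 0 , ≤-antisym f0≤q q≤f0
discrete-ivt f step {q} (suc T) f0≤q q≤fT+1 with q ≤? f T
... | yes q≤fT = discrete-ivt f step T f0≤q q≤fT
... | no  q≰fT = suc T , ≤-antisym (≤-trans (step T) (≰⇒> q≰fT)) q≤fT+1

falses trues : (ℕ → Bool) → ℕ → ℕ
falses m zero    = 0
falses m (suc Q) = (if m 0 then 0 else 1) + falses (m ∘ suc) Q
trues  m zero    = 0
trues  m (suc Q) = (if m 0 then 1 else 0) + trues (m ∘ suc) Q

falses+trues : ∀ m Q → falses m Q + trues m Q ≡ Q
falses+trues m zero = refl
falses+trues m (suc Q) with m 0
... | true  = trans (+-suc _ _) (cong suc (falses+trues (m ∘ suc) Q))
... | false = cong suc (falses+trues (m ∘ suc) Q)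

falses-cong : ∀ {a b} Q → (∀ c → c < Q → a c ≡ b c) → falses a Q ≡ falses b Q
falses-cong zero    _  = refl
falses-cong (suc Q) eq =
  cong₂ _+_ (cong (λ b → if b then 0 else 1) (eq 0 z<s)) (falses-cong Q (λ c → eq (suc c) ∘ s<s))

falses-all-true : ∀ {m} Q → (∀ c → c < Q → m c ≡ true) → falses m Q ≡ 0
falses-all-true zero    _   = refl
falses-all-true (suc Q) all rewrite all 0 z<s = falses-all-true Q (λ c → all (suc c) ∘ s<s)

falses-all-false : ∀ {m} Q → (∀ c → c < Q → m c ≡ false) → falses m Q ≡ Q
falses-all-false zero    _   = refl
falses-all-false (suc Q) all rewrite all 0 z<s = cong suc (falses-all-false Q (λ c → all (suc c) ∘ s<s))

falses-≤-suc : ∀ a b Q → (∀ c c′ → c < Q → c′ < Q → a c ≢ b c → a c′ ≢ b c′ → c ≡ c′) →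
  falses a Q ≤ suc (falses b Q)
falses-≤-suc a b zero    _    = z≤n
falses-≤-suc a b (suc Q) once with a 0 BP.≟ b 0
... | yes a0≡b0 rewrite a0≡b0 =
  ≤-trans (+-monoʳ-≤ (if b 0 then 0 else 1) (falses-≤-suc (a ∘ suc) (b ∘ suc) Q once′)) (≤-reflexive (+-suc _ _))
  where
  once′ : ∀ c c′ → c < Q → c′ < Q → a (suc c) ≢ b (suc c) → a (suc c′) ≢ b (suc c′) → c ≡ c′
  once′ c c′ c<Q c′<Q d d′ = suc-injective (once (suc c) (suc c′) (s<s c<Q) (s<s c′<Q) d d′)
... | no a0≢b0 = begin
  (if a 0 then 0 else 1) + falses (a ∘ suc) Q ≡⟨ cong (_ +_) (falses-cong Q agree) ⟩
  (if a 0 then 0 else 1) + falses (b ∘ suc) Q ≤⟨ +-monoˡ-≤ _ (indicator≤1 (a 0)) ⟩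
  suc (falses (b ∘ suc) Q)                    ≤⟨ s≤s (m≤n+m _ _) ⟩
  suc ((if b 0 then 0 else 1) + falses (b ∘ suc) Q) ∎
  where
  open ≤-Reasoning
  indicator≤1 : ∀ x → (if x then 0 else 1) ≤ 1
  indicator≤1 true  = z≤n
  indicator≤1 false = ≤-refl
  agree : ∀ c → c < Q → a (suc c) ≡ b (suc c)
  agree c c<Q with a (suc c) BP.≟ b (suc c)
  ... | yes eq = eq
  ... | no  d  = contradiction (once 0 (suc c) z<s (s<s c<Q) a0≢b0 d) λ ()

≤?-changes⇒≡ : ∀ {t x} → does (suc t ≤? x) ≢ does (t ≤? x) → x ≡ t
≤?-changes⇒≡ {t} {x} changes with <-cmp x t
... | tri≈ _ x≡t _ = x≡t
... | tri< x<t _ _ = contradiction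
  (trans (dec-false (suc t ≤? x) (<⇒≱ (m<n⇒m<1+n x<t))) (sym (dec-false (t ≤? x) (<⇒≱ x<t)))) changes
... | tri> _ _ t<x = contradiction
  (trans (dec-true (suc t ≤? x) t<x) (sym (dec-true (t ≤? x) (<⇒≤ t<x)))) changes

value-position< : ∀ {c Q} → c < Q → suc (2 * c) < 2 * Q
value-position< {c} c<Q = ≤-trans (≤-reflexive (sym (*-suc 2 c))) (*-monoʳ-≤ 2 c<Q)

value-position-injective : ∀ {c c′} → suc (2 * c) ≡ suc (2 * c′) → c ≡ c′
value-position-injective {c} {c′} eq = *-cancelˡ-≡ c c′ 2 (suc-injective eq)

-- Pair c is an α-pair (marker false) exactly when its value bit is read before step t.
marker : ∀ {n} → Permutation′ n → ℕ → ℕ → Bool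
marker π t c = does (t ≤? readingTime π (suc (2 * c)))

balanced-threshold : ∀ {n} (π : Permutation′ n) q → 2 * (2 * q) ≤ n → ∃[ t ] falses (marker π t) (2 * q) ≡ q
balanced-threshold {n} π q 4q≤n =
  discrete-ivt f step n (subst (_≤ q) (sym f0≡0) z≤n) (subst (q ≤_) (sym fn≡2q) (m≤m+n q (q + 0)))
  where
  f : ℕ → ℕ
  f t = falses (marker π t) (2 * q)
  value<n : ∀ {c} → c < 2 * q → suc (2 * c) < n
  value<n c<2q = <-≤-trans (value-position< c<2q) 4q≤n
  f0≡0 : f 0 ≡ 0
  f0≡0 = falses-all-true (2 * q) (λ c _ → dec-true (0 ≤? readingTime π (suc (2 * c))) z≤n)
  fn≡2q : f n ≡ 2 * q
  fn≡2q = falses-all-false (2 * q) λ c c<2q →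
    dec-false (n ≤? readingTime π (suc (2 * c))) (<⇒≱ (readingTime<n π (value<n c<2q)))
  step : ∀ t → f (suc t) ≤ suc (f t)
  step t = falses-≤-suc (marker π (suc t)) (marker π t) (2 * q) λ c c′ c<2q c′<2q d d′ →
    value-position-injective
      (readingTime-injective π (value<n c<2q) (value<n c′<2q) (trans (≤?-changes⇒≡ d) (sym (≤?-changes⇒≡ d′))))

bitAt : List Bool → ℕ → Bool
bitAt []       _       = false
bitAt (b ∷ _)  zero    = b
bitAt (_ ∷ bs) (suc p) = bitAt bs p

interleave : (ℕ → Bool) → ℕ → List Bool → List Bool → List Bool
interleave m zero    xs ys = []
interleave m (suc Q) xs ys =
  if m 0 then true  ∷ bitAt ys 0 ∷ interleave (m ∘ suc) Q xs (drop 1 ys)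
         else false ∷ bitAt xs 0 ∷ interleave (m ∘ suc) Q (drop 1 xs) ys

length-interleave : ∀ m Q xs ys → length (interleave m Q xs ys) ≡ 2 * Q
length-interleave m zero    xs ys = refl
length-interleave m (suc Q) xs ys with m 0
... | true  = trans (cong (suc ∘ suc) (length-interleave (m ∘ suc) Q xs (drop 1 ys))) (sym (*-suc 2 Q))
... | false = trans (cong (suc ∘ suc) (length-interleave (m ∘ suc) Q (drop 1 xs) ys)) (sym (*-suc 2 Q))

valuesWithMarker-false-interleave : ∀ m Q xs ys → length xs ≡ falses m Q →
  valuesWithMarker false (pairs (interleave m Q xs ys)) ≡ xs
valuesWithMarker-false-interleave m zero    []       ys _   = refl
valuesWithMarker-false-interleave m (suc Q) xs       ys len with m 0
... | true = valuesWithMarker-false-interleave (m ∘ suc) Q xs (drop 1 ys) len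
valuesWithMarker-false-interleave m (suc Q) (x ∷ xs) ys len | false =
  cong (x ∷_) (valuesWithMarker-false-interleave (m ∘ suc) Q xs ys (suc-injective len))

valuesWithMarker-true-interleave : ∀ m Q xs ys → length ys ≡ trues m Q →
  valuesWithMarker true (pairs (interleave m Q xs ys)) ≡ ys
valuesWithMarker-true-interleave m zero    xs []       _   = refl
valuesWithMarker-true-interleave m (suc Q) xs ys       len with m 0
... | false = valuesWithMarker-true-interleave (m ∘ suc) Q (drop 1 xs) ys len
valuesWithMarker-true-interleave m (suc Q) xs (y ∷ ys) len | true =
  cong (y ∷_) (valuesWithMarker-true-interleave (m ∘ suc) Q xs ys (suc-injective len))

ValueMarkedAt : Bool → (ℕ → Bool) → ℕ → ℕ → Set
ValueMarkedAt b m Q p = ∀ c → c < Q → p ≡ suc (2 * c) → m c ≡ b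

ValueMarkedAt-tail : ∀ {b m Q p} → ValueMarkedAt b m (suc Q) (suc (suc p)) → ValueMarkedAt b (m ∘ suc) Q p
ValueMarkedAt-tail marked c c<Q p≡ =
  marked (suc c) (s<s c<Q) (trans (cong (suc ∘ suc) p≡) (cong suc (sym (*-suc 2 c))))

bitAt-interleave-ignores-ys : ∀ m Q xs ys ys′ p → ValueMarkedAt false m Q p →
  bitAt (interleave m Q xs ys) p ≡ bitAt (interleave m Q xs ys′) p
bitAt-interleave-ignores-ys m zero    xs ys ys′ p marked = refl
bitAt-interleave-ignores-ys m (suc Q) xs ys ys′ p marked with m 0 in m0
bitAt-interleave-ignores-ys m (suc Q) xs ys ys′ zero          marked | false = refl
bitAt-interleave-ignores-ys m (suc Q) xs ys ys′ zero          marked | true  = refl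
bitAt-interleave-ignores-ys m (suc Q) xs ys ys′ (suc zero)    marked | false = refl
bitAt-interleave-ignores-ys m (suc Q) xs ys ys′ (suc zero)    marked | true  =
  contradiction (trans (sym m0) (marked 0 z<s refl)) λ ()
bitAt-interleave-ignores-ys m (suc Q) xs ys ys′ (suc (suc p)) marked | false =
  bitAt-interleave-ignores-ys (m ∘ suc) Q (drop 1 xs) ys ys′ p (ValueMarkedAt-tail marked)
bitAt-interleave-ignores-ys m (suc Q) xs ys ys′ (suc (suc p)) marked | true =
  bitAt-interleave-ignores-ys (m ∘ suc) Q xs (drop 1 ys) (drop 1 ys′) p (ValueMarkedAt-tail marked)

bitAt-interleave-ignores-xs : ∀ m Q xs xs′ ys p → ValueMarkedAt true m Q p →
  bitAt (interleave m Q xs ys) p ≡ bitAt (interleave m Q xs′ ys) p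
bitAt-interleave-ignores-xs m zero    xs xs′ ys p marked = refl
bitAt-interleave-ignores-xs m (suc Q) xs xs′ ys p marked with m 0 in m0
bitAt-interleave-ignores-xs m (suc Q) xs xs′ ys zero          marked | false = refl
bitAt-interleave-ignores-xs m (suc Q) xs xs′ ys zero          marked | true  = refl
bitAt-interleave-ignores-xs m (suc Q) xs xs′ ys (suc zero)    marked | true  = refl
bitAt-interleave-ignores-xs m (suc Q) xs xs′ ys (suc zero)    marked | false =
  contradiction (trans (sym m0) (marked 0 z<s refl)) λ ()
bitAt-interleave-ignores-xs m (suc Q) xs xs′ ys (suc (suc p)) marked | true =
  bitAt-interleave-ignores-xs (m ∘ suc) Q xs xs′ (drop 1 ys) p (ValueMarkedAt-tail marked)
bitAt-interleave-ignores-xs m (suc Q) xs xs′ ys (suc (suc p)) marked | false =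
  bitAt-interleave-ignores-xs (m ∘ suc) Q (drop 1 xs) (drop 1 xs′) ys p (ValueMarkedAt-tail marked)

pad : ∀ n → List Bool → Vec Bool n
pad n bs = tabulate (bitAt bs ∘ toℕ)

lookup-pad : ∀ n bs i → lookup (pad n bs) i ≡ bitAt bs (toℕ i)
lookup-pad n bs = lookup∘tabulate (bitAt bs ∘ toℕ)

take-pad : ∀ n bs {k} → length bs ≡ k → k ≤ n → take k (toList (pad n bs)) ≡ bs
take-pad n       []       refl _         = refl
take-pad (suc n) (b ∷ bs) refl (s≤s len≤n) = cong (b ∷_) (take-pad n bs refl len≤n)

alpha-pad-interleave : ∀ {n} m Q xs ys → 2 * Q ≤ n → length xs ≡ falses m Q →
  alpha (2 * Q) (pad n (interleave m Q xs ys)) ≡ xs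
alpha-pad-interleave {n} m Q xs ys 2Q≤n len =
  trans (cong (valuesWithMarker false ∘ pairs) (take-pad n (interleave m Q xs ys) (length-interleave m Q xs ys) 2Q≤n))
        (valuesWithMarker-false-interleave m Q xs ys len)

beta-pad-interleave : ∀ {n} m Q xs ys → 2 * Q ≤ n → length ys ≡ trues m Q →
  beta (2 * Q) (pad n (interleave m Q xs ys)) ≡ ys
beta-pad-interleave {n} m Q xs ys 2Q≤n len =
  trans (cong (valuesWithMarker true ∘ pairs) (take-pad n (interleave m Q xs ys) (length-interleave m Q xs ys) 2Q≤n))
        (valuesWithMarker-true-interleave m Q xs ys len)

interleave-splitAt : ∀ {n T} (π : Permutation′ n) t Q (xs ys : Fin T → List Bool) →
  SplitAt t (λ x y j → lookup (pad n (interleave (marker π t) Q (xs x) (ys y))) (π ⟨$⟩ʳ j))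
interleave-splitAt {n} {T} π t Q xs ys = before , after
  where
  read-at : ∀ {j c} → toℕ (π ⟨$⟩ʳ j) ≡ suc (2 * c) → readingTime π (suc (2 * c)) ≡ toℕ j
  read-at e = trans (cong (readingTime π) (sym e)) (readingTime-⟨$⟩ʳ π _)
  word : Fin T → Fin T → List Bool
  word x y = interleave (marker π t) Q (xs x) (ys y)
  before : ∀ x y y′ j → toℕ j < t →
    lookup (pad n (word x y)) (π ⟨$⟩ʳ j) ≡ lookup (pad n (word x y′)) (π ⟨$⟩ʳ j)
  before x y y′ j j<t = trans (lookup-pad n (word x y) _) (trans
    (bitAt-interleave-ignores-ys (marker π t) Q (xs x) (ys y) (ys y′) (toℕ (π ⟨$⟩ʳ j))
      (λ c _ e → dec-false (t ≤? _) (<⇒≱ j<t ∘ subst (t ≤_) (read-at {j} {c} e))))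
    (sym (lookup-pad n (word x y′) _)))
  after : ∀ x x′ y j → t ≤ toℕ j →
    lookup (pad n (word x y)) (π ⟨$⟩ʳ j) ≡ lookup (pad n (word x′ y)) (π ⟨$⟩ʳ j)
  after x x′ y j t≤j = trans (lookup-pad n (word x y) _) (trans
    (bitAt-interleave-ignores-xs (marker π t) Q (xs x) (xs x′) (ys y) (toℕ (π ⟨$⟩ʳ j))
      (λ c _ e → dec-true (t ≤? _) (subst (t ≤_) (sym (read-at {j} {c} e)) t≤j)))
    (sym (lookup-pad n (word x′ y) _)))

bits : ∀ q → Fin (2 ^ q) → List Bool
bits zero    _ = []
bits (suc q) i = Inverse.to 2↔Bool (proj₁ (remQuot {2} (2 ^ q) i)) ∷ bits q (proj₂ (remQuot {2} (2 ^ q) i))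

length-bits : ∀ q i → length (bits q i) ≡ q
length-bits zero    _ = refl
length-bits (suc q) i = cong suc (length-bits q _)

bits-injective : ∀ q {i j} → bits q i ≡ bits q j → i ≡ j
bits-injective zero {Fin.zero} {Fin.zero} _ = refl
bits-injective (suc q) {i} {j} eq = begin
  i                           ≡⟨ combine-remQuot {2} (2 ^ q) i ⟨
  uncurry combine (split i)   ≡⟨ cong (uncurry combine) (cong₂ _,_ heads tails) ⟩
  uncurry combine (split j)   ≡⟨ combine-remQuot {2} (2 ^ q) j ⟩
  j                           ∎
  where
  open ≡-Reasoning
  split : Fin (2 ^ suc q) → Fin 2 × Fin (2 ^ q)
  split = remQuot {2} (2 ^ q)
  heads : proj₁ (split i) ≡ proj₁ (split j)
  heads = trans (sym (Inverse.strictlyInverseʳ 2↔Bool _))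
                (trans (cong (Inverse.from 2↔Bool) (LP.∷-injectiveˡ eq)) (Inverse.strictlyInverseʳ 2↔Bool _))
  tails : proj₂ (split i) ≡ proj₂ (split j)
  tails = bits-injective q (LP.∷-injectiveʳ eq)

NotEQS≡false⇒α≡β : ∀ k n ν → NotEQS k n ν ≡ false → alpha k ν ≡ beta k ν
NotEQS≡false⇒α≡β k n ν rejects with LP.≡-dec BP._≟_ (alpha k ν) (beta k ν)
... | yes α≡β = α≡β
... | no  _   = contradiction rejects λ ()

α≡β⇒NotEQS≡false : ∀ k n ν → alpha k ν ≡ beta k ν → NotEQS k n ν ≡ false
α≡β⇒NotEQS≡false k n ν α≡β with LP.≡-dec BP._≟_ (alpha k ν) (beta k ν)
... | yes _   = refl
... | no  α≢β = contradiction α≡β α≢β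

NotEQS-width : ∀ q n → 2 * (2 * q) ≤ n → (B : OBDD n) → Computes B (NotEQS (2 * (2 * q)) n) → 2 ^ q ≤ width B
NotEQS-width q n 4q≤n B computes =
  obdd-fooling-bound B input t (interleave-splitAt π t Q (bits q) (bits q)) rejects⇒≡ rejects-diagonal
  where
  π = order B
  Q = 2 * q
  k = 2 * Q
  t = proj₁ (balanced-threshold π q 4q≤n)
  α-pairs : falses (marker π t) Q ≡ q
  α-pairs = proj₂ (balanced-threshold π q 4q≤n)
  β-pairs : trues (marker π t) Q ≡ q
  β-pairs = +-cancelˡ-≡ q _ _ (begin
    q + trues (marker π t) Q                        ≡⟨ cong (_+ trues (marker π t) Q) α-pairs ⟨
    falses (marker π t) Q + trues (marker π t) Q    ≡⟨ falses+trues (marker π t) Q ⟩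
    2 * q                                           ≡⟨ cong (q +_) (*-identityˡ q) ⟩
    q + q                                           ∎)
    where open ≡-Reasoning
  input : Fin (2 ^ q) → Fin (2 ^ q) → Vec Bool n
  input x y = pad n (interleave (marker π t) Q (bits q x) (bits q y))
  α-input : ∀ x y → alpha k (input x y) ≡ bits q x
  α-input x y = alpha-pad-interleave _ Q _ _ 4q≤n (trans (length-bits q x) (sym α-pairs))
  β-input : ∀ x y → beta k (input x y) ≡ bits q y
  β-input x y = beta-pad-interleave _ Q _ _ 4q≤n (trans (length-bits q y) (sym β-pairs))
  rejects⇒≡ : ∀ x y → eval B (input x y) ≡ false → x ≡ y
  rejects⇒≡ x y rejects = bits-injective q (begin
    bits q x            ≡⟨ α-input x y ⟨
    alpha k (input x y) ≡⟨ NotEQS≡false⇒α≡β k n (input x y) (trans (sym (computes _)) rejects) ⟩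
    beta k (input x y)  ≡⟨ β-input x y ⟩
    bits q y            ∎)
    where open ≡-Reasoning
  rejects-diagonal : ∀ x → eval B (input x x) ≡ false
  rejects-diagonal x = trans (computes _) (α≡β⇒NotEQS≡false k n (input x x) (trans (α-input x x) (sym (β-input x x))))

n<2^n : ∀ n → n < 2 ^ n
n<2^n zero    = z<s
n<2^n (suc n) = +-mono-≤ (≤-trans (s≤s z≤n) (n<2^n n)) (≤-trans (n<2^n n) (m≤m+n (2 ^ n) 0))

lemma8 : (k : ℕ) → 4 ∣ k → 4 ≤ k →
    (N : ℕ) → Σ ℕ λ n → N ≤ n × k ≤ n × k ^ 4 ≤ 2 ^ n ×
      ((B : OBDD n) → Computes B (NotEQS k n) → 2 ^ (k / 4) ≤ width B)
lemma8 _ (divides q refl) _ N =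
  n , m≤m+n N _ , k≤n , k^4≤2^n , λ B computes →
    subst (λ e → 2 ^ e ≤ width B) (sym (m*n/n≡m q 4))
      (NotEQS-width q n (subst (_≤ n) k≡4q k≤n) B (subst (λ e → Computes B (NotEQS e n)) k≡4q computes))
  where
  k = q * 4
  n = N + (k + k ^ 4)
  k≤n : k ≤ n
  k≤n = ≤-trans (m≤m+n k _) (m≤n+m _ N)
  k≡4q : k ≡ 2 * (2 * q)
  k≡4q = trans (*-comm q 4) (*-assoc 2 2 q)
  k^4≤2^n : k ^ 4 ≤ 2 ^ n
  k^4≤2^n = ≤-trans (<⇒≤ (n<2^n (k ^ 4))) (^-monoʳ-≤ 2 (≤-trans (m≤n+m (k ^ 4) k) (m≤n+m _ N)))
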